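{- For each even integer $k\ge 4$ and each integer $n$ with $2k\le n\le 3k-2$, we have $d(n,2(k-1),\chi=k)=k-1$.
   Context: All graphs are finite and simple. For a graph $G$, $\chi(G)$ denotes its chromatic number. A set $S$ of vertices of $G$ together with an assignment of colors to the vertices of $S$ is a defining set of the vertex coloring of $G$ if this partial coloring extends in exactly one way to a proper coloring of all vertices of $G$ with $\chi(G)$ colors. The defining number $d(G,\chi)$ is the minimum cardinality of a defining set of $G$. For integers $n,r,k$, $d(n,r,\chi=k)$ denotes the minimum of $d(G,\chi)$ over all $r$-regular graphs $G$ on $n$ vertices with $\chi(G)=k$. -}

module Defs where

open import Data.Nat using (ℕ; _≤_)
open import Data.Bool using (Bool; true; false)
open import Data.Fin using (Fin)
open import Data.Fin.Subset using (Subset; _∈_; ∣_∣)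
open import Data.Vec using (tabulate)
open import Data.Product using (Σ; _×_)
open import Relation.Binary.PropositionalEquality using (_≡_; _≢_)

record Graph (n : ℕ) : Set where
  field
    adj   : Fin n → Fin n → Bool
    sym   : ∀ u v → adj u v ≡ adj v u
    irrefl : ∀ v → adj v v ≡ false
open Graph public

Adj : ∀ {n} → Graph n → Fin n → Fin n → Set
Adj G u v = adj G u v ≡ true

degree : ∀ {n} → Graph n → Fin n → ℕ
degree G u = ∣ tabulate (adj G u) ∣

Regular : ∀ {n} → Graph n → ℕ → Set
Regular G r = ∀ v → degree G v ≡ r

Proper : ∀ {n c} → Graph n → (Fin n → Fin c) → Set
Proper G f = ∀ u v → Adj G u v → f u ≢ f v

Colorable : ∀ {n} → Graph n → ℕ → Set
Colorable {n} G c = Σ (Fin n → Fin c) (Proper G)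

ChromaticNumber : ∀ {n} → Graph n → ℕ → Set
ChromaticNumber G k = Colorable G k × (∀ c → Colorable G c → k ≤ c)

-- (S , p) : the set S with colours p restricted to S (values of p off S
-- are irrelevant).  f extends (S , p) if it agrees with p on S.
Extends : ∀ {n k} → Subset n → (Fin n → Fin k) → (Fin n → Fin k) → Set
Extends S p f = ∀ v → v ∈ S → f v ≡ p v

IsDefiningSet : ∀ {n} → Graph n → (k : ℕ) → Subset n → (Fin n → Fin k) → Set
IsDefiningSet {n} G k S p =
  Σ (Fin n → Fin k) (λ f → Proper G f × Extends S p f)
  × (∀ f g → Proper G f → Extends S p f → Proper G g → Extends S p g →
       ∀ v → f v ≡ g v)

DefiningNumber : ∀ {n} → Graph n → (k : ℕ) → ℕ → Set
DefiningNumber {n} G k m =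
  Σ (Subset n) (λ S → Σ (Fin n → Fin k) (λ p → IsDefiningSet G k S p × ∣ S ∣ ≡ m))
  × (∀ S p → IsDefiningSet G k S p → m ≤ ∣ S ∣)

-- d(n, r, χ = k) = m : the minimum of d(G,χ) over all r-regular graphs G on
-- n vertices with χ(G) = k equals m (in particular such a G exists).
MinRegDefiningNumber : ℕ → ℕ → ℕ → ℕ → Set
MinRegDefiningNumber n r k m =
  Σ (Graph n) (λ G → Regular G r × ChromaticNumber G k × DefiningNumber G k m)
  × (∀ (G : Graph n) → Regular G r → ChromaticNumber G k →
       ∀ d → DefiningNumber G k d → m ≤ d)

-- Lower bound: if a defining set of a colouring with χ(G) colours misses two colours, swapping
-- them in its unique extension gives another extension, so the extension misses a colour,
-- contradicting minimality of χ(G).  Hence d(G, χ) ≥ χ(G) − 1 for every graph G.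
--
-- Upper bound: write n = 2k + s with s ≤ k − 2 and r = k − 1 − s ≥ 1.  On vertices x a, y a
-- (a < k) and z i (i < s) let the complement H of G have the edges x a ~ y b for a = b or
-- a → b in a digraph on [0, k) with in- and out-degree s − [a > r] whose arcs leaving a < r
-- go upwards; x a ~ z i and y a ~ z i for a = r + 1 + i; and all z i ~ z j.  H is
-- (s + 1)-regular, so G is 2(k − 1)-regular; X is a k-clique of G, and x a, y a ↦ a,
-- z i ↦ r + 1 + i is a proper k-colouring.  With c₀ = r + 1 (mod k), the k − 1 vertices
-- (X ∖ {x c₀, x r}) ∪ {y r} force it: x c₀ sees every other colour (r on y r, as c₀ → r is
-- not an arc), then x r does, then Z, and finally y c by induction on c.

module Submission where

open import Data.Bool.Base using (Bool; true; false; _∧_; _∨_; not; if_then_else_)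
open import Data.Bool.Properties using (∧-zeroʳ; ∧-identityʳ; ∨-zeroʳ; ∨-identityʳ)
open import Data.Empty using (⊥-elim)
open import Data.Fin.Base using (Fin; toℕ; fromℕ<)
open import Data.Fin.Properties using (toℕ<n; toℕ-fromℕ<; toℕ-injective)
open import Data.Fin.Subset using (Subset; _∈_; ∣_∣)
open import Data.Nat.Base
open import Data.Nat.Divisibility using (_∣_)
open import Data.Nat.Induction using (<-rec)
open import Data.Nat.Properties
open import Data.Nat.Tactic.RingSolver using (solve-∀)
open import Data.Product.Base using (∃; _×_; _,_; proj₂)
open import Data.Sum.Base using (inj₁; inj₂)
open import Data.Vec.Base using (tabulate)
open import Data.Vec.Properties using (lookup⇒[]=; lookup∘tabulate)
open import Function.Base using (_∘_)
open import Relation.Binary.Definitions using (tri<; tri≈; tri>)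
open import Relation.Binary.PropositionalEquality
open import Relation.Nullary using (yes; no)
open import Relation.Nullary.Reflects using (Reflects; ofʸ; ofⁿ; fromEquivalence; det)

open import Defs hiding (sym; irrefl)

≡ᵇ-reflects-≡ : ∀ m n → Reflects (m ≡ n) (m ≡ᵇ n)
≡ᵇ-reflects-≡ m n = fromEquivalence (≡ᵇ⇒≡ m n) (≡⇒≡ᵇ m n)

≡ᵇ-sym : ∀ m n → (m ≡ᵇ n) ≡ (n ≡ᵇ m)
≡ᵇ-sym zero    zero    = refl
≡ᵇ-sym zero    (suc n) = refl
≡ᵇ-sym (suc m) zero    = refl
≡ᵇ-sym (suc m) (suc n) = ≡ᵇ-sym m n

≡ᵇ-refl : ∀ n → (n ≡ᵇ n) ≡ true
≡ᵇ-refl zero    = refl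
≡ᵇ-refl (suc n) = ≡ᵇ-refl n

≡ᵇ-true : ∀ {m n} → m ≡ n → (m ≡ᵇ n) ≡ true
≡ᵇ-true {m} {n} m≡n = det (≡ᵇ-reflects-≡ m n) (ofʸ m≡n)

≡ᵇ-false : ∀ {m n} → m ≢ n → (m ≡ᵇ n) ≡ false
≡ᵇ-false {m} {n} m≢n = det (≡ᵇ-reflects-≡ m n) (ofⁿ m≢n)

invert-true : ∀ {P : Set} {b} → Reflects P b → b ≡ true → P
invert-true (ofʸ p) _ = p

∧-true⁻ : ∀ {x y} → x ∧ y ≡ true → x ≡ true × y ≡ true
∧-true⁻ {true} {true} _ = refl , refl

bool→ℕ : Bool → ℕ
bool→ℕ true  = 1
bool→ℕ false = 0

module Counting where

  count : (ℕ → Bool) → ℕ → ℕ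
  count f zero    = 0
  count f (suc n) = bool→ℕ (f 0) + count (λ i → f (suc i)) n

  count-cong : ∀ n {f g : ℕ → Bool} → (∀ i → i < n → f i ≡ g i) → count f n ≡ count g n
  count-cong zero    f≗g = refl
  count-cong (suc n) f≗g =
    cong₂ _+_ (cong bool→ℕ (f≗g 0 z<s)) (count-cong n (λ i i<n → f≗g (suc i) (s<s i<n)))

  count-+ : ∀ m n (f : ℕ → Bool) → count f (m + n) ≡ count f m + count (λ i → f (m + i)) n
  count-+ zero    n f = refl
  count-+ (suc m) n f =
    trans (cong (bool→ℕ (f 0) +_) (count-+ m n (λ i → f (suc i))))
          (sym (+-assoc (bool→ℕ (f 0)) _ _))

  count-none : ∀ n {f : ℕ → Bool} → (∀ i → i < n → f i ≡ false) → count f n ≡ 0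
  count-none zero    f≗false = refl
  count-none (suc n) f≗false rewrite f≗false 0 z<s =
    count-none n (λ i i<n → f≗false (suc i) (s<s i<n))

  count-all : ∀ n {f : ℕ → Bool} → (∀ i → i < n → f i ≡ true) → count f n ≡ n
  count-all zero    f≗true = refl
  count-all (suc n) f≗true rewrite f≗true 0 z<s =
    cong suc (count-all n (λ i i<n → f≗true (suc i) (s<s i<n)))

  count-≡ᵇ : ∀ n a → a < n → count (_≡ᵇ a) n ≡ 1
  count-≡ᵇ (suc n) zero    _       = cong suc (count-none n (λ _ _ → refl))
  count-≡ᵇ (suc n) (suc a) (s<s p) = count-≡ᵇ n a p

  count-+-∨-∧ : ∀ n (f g : ℕ → Bool) →
    count f n + count g n ≡ count (λ i → f i ∨ g i) n + count (λ i → f i ∧ g i) n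
  count-+-∨-∧ zero    f g = refl
  count-+-∨-∧ (suc n) f g with f 0 | g 0 | count-+-∨-∧ n (λ i → f (suc i)) (λ i → g (suc i))
  ... | true  | true  | ih = cong suc (trans (+-suc _ _) (trans (cong suc ih) (sym (+-suc _ _))))
  ... | true  | false | ih = cong suc ih
  ... | false | true  | ih = trans (+-suc _ _) (cong suc ih)
  ... | false | false | ih = ih

  count-∨-disjoint : ∀ n (f g : ℕ → Bool) → (∀ i → i < n → f i ∧ g i ≡ false) →
    count (λ i → f i ∨ g i) n ≡ count f n + count g n
  count-∨-disjoint n f g disjoint = begin
    count (λ i → f i ∨ g i) n                                ≡⟨ +-identityʳ _ ⟨
    count (λ i → f i ∨ g i) n + 0                            ≡⟨ cong (count (λ i → f i ∨ g i) n +_) (count-none n disjoint) ⟨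
    count (λ i → f i ∨ g i) n + count (λ i → f i ∧ g i) n    ≡⟨ count-+-∨-∧ n f g ⟨
    count f n + count g n                                    ∎
    where open ≡-Reasoning

  count-∨-≤ : ∀ n (f g : ℕ → Bool) → count (λ i → f i ∨ g i) n ≤ count f n + count g n
  count-∨-≤ n f g = subst (count (λ i → f i ∨ g i) n ≤_) (sym (count-+-∨-∧ n f g)) (m≤m+n _ _)

  count-∧-split : ∀ n (f g : ℕ → Bool) →
    count f n ≡ count (λ i → f i ∧ not (g i)) n + count (λ i → f i ∧ g i) n
  count-∧-split zero    f g = refl
  count-∧-split (suc n) f g with f 0 | g 0 | count-∧-split n (λ i → f (suc i)) (λ i → g (suc i))
  ... | true  | true  | ih = trans (cong suc ih) (sym (+-suc _ _))
  ... | true  | false | ih = cong suc ih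
  ... | false | _     | ih = ih

  count-complement : ∀ n (f : ℕ → Bool) → count f n + count (λ i → not (f i)) n ≡ n
  count-complement zero    f = refl
  count-complement (suc n) f with f 0 | count-complement n (λ i → f (suc i))
  ... | true  | ih = cong suc ih
  ... | false | ih = trans (+-suc _ _) (cong suc ih)

  count-∧-≡ᵇ : ∀ n t (b : Bool) → t < n → count (λ i → b ∧ (i ≡ᵇ t)) n ≡ bool→ℕ b
  count-∧-≡ᵇ n t true  t<n = count-≡ᵇ n t t<n
  count-∧-≡ᵇ n t false t<n = count-none n (λ _ _ → refl)

  count-modify : ∀ n (c d a : ℕ → Bool) L → (∀ i → i < n → d i ≡ true → c i ≡ true) →
    (∀ i → i < n → (c i ∧ not (d i)) ∧ a i ≡ false) → count a n + L ≡ count d n →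
    count (λ i → (c i ∧ not (d i)) ∨ a i) n + L ≡ count c n
  count-modify n c d a L d⊆c disjoint balance = begin
    count (λ i → (c i ∧ not (d i)) ∨ a i) n + L      ≡⟨ cong (_+ L) (count-∨-disjoint n _ a disjoint) ⟩
    (count (λ i → c i ∧ not (d i)) n + count a n) + L ≡⟨ +-assoc (count (λ i → c i ∧ not (d i)) n) _ L ⟩
    count (λ i → c i ∧ not (d i)) n + (count a n + L) ≡⟨ cong (count (λ i → c i ∧ not (d i)) n +_) balance ⟩
    count (λ i → c i ∧ not (d i)) n + count d n       ≡⟨ cong (count (λ i → c i ∧ not (d i)) n +_)
                                                           (count-cong n λ i i<n → c∧d≡d (c i) (d i) (d⊆c i i<n)) ⟨
    count (λ i → c i ∧ not (d i)) n + count (λ i → c i ∧ d i) n ≡⟨ count-∧-split n c d ⟨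
    count c n                                         ∎
    where
    open ≡-Reasoning
    c∧d≡d : ∀ x y → (y ≡ true → x ≡ true) → x ∧ y ≡ y
    c∧d≡d true  y y⇒x = refl
    c∧d≡d false true  y⇒x = y⇒x refl
    c∧d≡d false false y⇒x = refl

  count-≡ᵇ-+ : ∀ m n a → a < m + n → count (λ i → a ≡ᵇ m + i) n ≡ bool→ℕ (m ≤ᵇ a)
  count-≡ᵇ-+ zero    n a       a<n = trans (count-cong n λ i _ → ≡ᵇ-sym a i) (count-≡ᵇ n a a<n)
  count-≡ᵇ-+ (suc m) n zero    _   = count-none n (λ _ _ → refl)
  count-≡ᵇ-+ (suc m) n (suc a) a<m+n =
    trans (count-≡ᵇ-+ m n a (s≤s⁻¹ a<m+n)) (cong bool→ℕ (≤ᵇ-<ᵇ-suc m a))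
    where
    ≤ᵇ-<ᵇ-suc : ∀ m a → (m ≤ᵇ a) ≡ (m <ᵇ suc a)
    ≤ᵇ-<ᵇ-suc zero    a = refl
    ≤ᵇ-<ᵇ-suc (suc m) a = refl

  ∣tabulate∣ : ∀ n (f : ℕ → Bool) → ∣ tabulate {n = n} (λ i → f (toℕ i)) ∣ ≡ count f n
  ∣tabulate∣ zero    f = refl
  ∣tabulate∣ (suc n) f with f 0
  ... | true  = cong suc (∣tabulate∣ n (λ i → f (suc i)))
  ... | false = ∣tabulate∣ n (λ i → f (suc i))

  count-witness : ∀ n (f : ℕ → Bool) → 1 ≤ count f n → ∃ λ i → i < n × f i ≡ true
  count-witness (suc n) f pos with f 0 in f0
  ... | true  = 0 , z<s , f0
  ... | false with count-witness n (λ i → f (suc i)) pos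
  ...   | i , i<n , fi = suc i , s<s i<n , fi

  count-two-witnesses : ∀ n (f : ℕ → Bool) → 2 ≤ count f n →
    ∃ λ i → ∃ λ j → i < n × j < n × i ≢ j × f i ≡ true × f j ≡ true
  count-two-witnesses (suc n) f two with f 0 in f0
  ... | true with count-witness n (λ i → f (suc i)) (s≤s⁻¹ two)
  ...   | j , j<n , fj = 0 , suc j , z<s , s<s j<n , (λ ()) , f0 , fj
  count-two-witnesses (suc n) f two | false
    with count-two-witnesses n (λ i → f (suc i)) two
  ... | i , j , i<n , j<n , i≢j , fi , fj =
    suc i , suc j , s<s i<n , s<s j<n , (λ eq → i≢j (suc-injective eq)) , fi , fj

  anyBelow : (ℕ → Bool) → ℕ → Bool
  anyBelow f zero    = false
  anyBelow f (suc m) = anyBelow f m ∨ f m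

  anyBelow-witness : ∀ m (f : ℕ → Bool) → anyBelow f m ≡ true → ∃ λ d → d < m × f d ≡ true
  anyBelow-witness (suc m) f any with anyBelow f m in before
  ... | true  = let d , d<m , fd = anyBelow-witness m f before in d , m<n⇒m<1+n d<m , fd
  ... | false = m , ≤-refl , any

  anyBelow-intro : ∀ m (f : ℕ → Bool) d → d < m → f d ≡ true → anyBelow f m ≡ true
  anyBelow-intro (suc m) f d d<1+m fd with m≤n⇒m<n∨m≡n (s≤s⁻¹ d<1+m)
  ... | inj₁ d<m  rewrite anyBelow-intro m f d d<m fd = refl
  ... | inj₂ refl rewrite fd = ∨-zeroʳ (anyBelow f m)

  anyBelow-none : ∀ m (f : ℕ → Bool) → (∀ d → d < m → f d ≡ false) → anyBelow f m ≡ false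
  anyBelow-none zero    f none = refl
  anyBelow-none (suc m) f none
    rewrite anyBelow-none m f (λ d d<m → none d (m<n⇒m<1+n d<m)) = none m ≤-refl

  anyBelow-cong : ∀ m {f g : ℕ → Bool} → (∀ d → d < m → f d ≡ g d) → anyBelow f m ≡ anyBelow g m
  anyBelow-cong zero    f≗g = refl
  anyBelow-cong (suc m) f≗g =
    cong₂ _∨_ (anyBelow-cong m (λ d d<m → f≗g d (m<n⇒m<1+n d<m))) (f≗g m ≤-refl)

  image : (ℕ → ℕ) → ℕ → ℕ → Bool
  image h m x = anyBelow (λ d → x ≡ᵇ h d) m

  count-image : ∀ n m (h : ℕ → ℕ) → (∀ d → d < m → h d < n) →
    (∀ d d′ → d < m → d′ < m → h d ≡ h d′ → d ≡ d′) → count (image h m) n ≡ m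
  count-image n zero    h h<n h-inj = count-none n (λ _ _ → refl)
  count-image n (suc m) h h<n h-inj = begin
    count (λ x → image h m x ∨ (x ≡ᵇ h m)) n          ≡⟨ count-∨-disjoint n _ _ disjoint ⟩
    count (image h m) n + count (_≡ᵇ h m) n           ≡⟨ cong₂ _+_ ih (count-≡ᵇ n (h m) (h<n m ≤-refl)) ⟩
    m + 1                                             ≡⟨ +-comm m 1 ⟩
    suc m                                             ∎
    where
    open ≡-Reasoning
    ih : count (image h m) n ≡ m
    ih = count-image n m h (λ d d<m → h<n d (m<n⇒m<1+n d<m))
           (λ d d′ d<m d′<m → h-inj d d′ (m<n⇒m<1+n d<m) (m<n⇒m<1+n d′<m))
    disjoint : ∀ x → x < n → image h m x ∧ (x ≡ᵇ h m) ≡ false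
    disjoint x _ with x ≡ᵇ h m | ≡ᵇ-reflects-≡ x (h m)
    ... | false | _      = ∧-zeroʳ _
    ... | true  | ofʸ refl = trans (∧-identityʳ _) (anyBelow-none m _ λ d d<m →
          ≡ᵇ-false λ eq → <-irrefl (h-inj d m (m<n⇒m<1+n d<m) ≤-refl (sym eq)) d<m)

open Counting

module Cyclic (k : ℕ) where

  -- Addition and subtraction modulo k, meaningful for j, c < k and e ≤ k.
  _⊕_ : ℕ → ℕ → ℕ
  j ⊕ e = if j + e <ᵇ k then j + e else j + e ∸ k

  _⊖_ : ℕ → ℕ → ℕ
  c ⊖ e = if e ≤ᵇ c then c ∸ e else c + k ∸ e

  data ⊕-View (j e : ℕ) : ℕ → Set where
    no-wrap : j + e < k → ⊕-View j e (j + e)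
    wrap    : ∀ w → j + e ≡ k + w → ⊕-View j e w

  ⊕-view : ∀ j e → ⊕-View j e (j ⊕ e)
  ⊕-view j e with j + e <ᵇ k | <ᵇ-reflects-< (j + e) k
  ... | true  | ofʸ j+e<k = no-wrap j+e<k
  ... | false | ofⁿ j+e≮k = wrap _ (sym (m+[n∸m]≡n (≮⇒≥ j+e≮k)))

  data ⊖-View (c e : ℕ) : ℕ → Set where
    no-wrap : ∀ w → c ≡ w + e → ⊖-View c e w
    wrap    : ∀ w → c < e → c + k ≡ w + e → ⊖-View c e w

  ⊖-view : ∀ c e → e ≤ k → ⊖-View c e (c ⊖ e)
  ⊖-view c e e≤k with e ≤ᵇ c | ≤ᵇ-reflects-≤ e c
  ... | true  | ofʸ e≤c = no-wrap _ (sym (m∸n+n≡m e≤c))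
  ... | false | ofⁿ e≰c = wrap _ (≰⇒> e≰c) (sym (m∸n+n≡m (≤-trans e≤k (m≤n+m k c))))

  ⊕-< : ∀ j e → j < k → e ≤ k → j ⊕ e < k
  ⊕-< j e j<k e≤k with j ⊕ e | ⊕-view j e
  ... | _ | no-wrap j+e<k = j+e<k
  ... | w | wrap .w eq    = +-cancelˡ-< k w k (subst (_< k + k) eq (+-mono-<-≤ j<k e≤k))

  ⊖-< : ∀ c e → c < k → e ≤ k → c ⊖ e < k
  ⊖-< c e c<k e≤k with c ⊖ e | ⊖-view c e e≤k
  ... | w | no-wrap .w eq    = ≤-<-trans (subst (w ≤_) (sym eq) (m≤m+n w e)) c<k
  ... | w | wrap .w c<e eq =
    +-cancelʳ-< e w k (subst (_< k + e) eq (subst (c + k <_) (+-comm e k) (+-monoˡ-< k c<e)))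

  ⊕-no-wrap : ∀ j e → j + e < k → j ⊕ e ≡ j + e
  ⊕-no-wrap j e j+e<k with j ⊕ e | ⊕-view j e
  ... | _ | no-wrap _  = refl
  ... | w | wrap .w eq = ⊥-elim (<⇒≱ j+e<k (subst (k ≤_) (sym eq) (m≤m+n k w)))

  ⊕⇒⊖ : ∀ j c e → j < k → e ≤ k → c ≡ j ⊕ e → j ≡ c ⊖ e
  ⊕⇒⊖ j c e j<k e≤k c≡j⊕e with j ⊕ e | ⊕-view j e | c ⊖ e | ⊖-view c e e≤k
  ... | _ | no-wrap _    | w | no-wrap .w eq   = +-cancelʳ-≡ e j w (trans (sym c≡j⊕e) eq)
  ... | _ | no-wrap _    | w | wrap .w c<e eq  =
    ⊥-elim (<⇒≱ c<e (subst (e ≤_) (sym c≡j⊕e) (m≤n+m e j)))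
  ... | v | wrap .v eqv  | w | no-wrap .w eq   = ⊥-elim (<⇒≱ j<k (+-cancelʳ-≤ e k j
    (subst (k + e ≤_) (sym eqv) (+-monoʳ-≤ k (subst (e ≤_) (trans (sym eq) c≡j⊕e) (m≤n+m e w))))))
  ... | v | wrap .v eqv  | w | wrap .w c<e eq  =
    +-cancelʳ-≡ e j w (trans eqv (trans (cong (k +_) (sym c≡j⊕e)) (trans (+-comm k c) eq)))

  ⊖⇒⊕ : ∀ j c e → c < k → e ≤ k → j ≡ c ⊖ e → c ≡ j ⊕ e
  ⊖⇒⊕ j c e c<k e≤k j≡c⊖e with c ⊖ e | ⊖-view c e e≤k | j ⊕ e | ⊕-view j e
  ... | w | no-wrap .w eq   | _ | no-wrap _   = trans eq (cong (_+ e) (sym j≡c⊖e))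
  ... | w | no-wrap .w eq   | v | wrap .v eqv = ⊥-elim (<⇒≱ c<k
    (subst (k ≤_) (trans (cong (_+ e) j≡c⊖e) (sym eq)) (subst (k ≤_) (sym eqv) (m≤m+n k v))))
  ... | w | wrap .w c<e eq  | _ | no-wrap j+e<k = ⊥-elim (<⇒≱ j+e<k
    (subst (k ≤_) (trans eq (cong (_+ e) (sym j≡c⊖e))) (m≤n+m k c)))
  ... | w | wrap .w c<e eq  | v | wrap .v eqv =
    +-cancelˡ-≡ k c v (trans (+-comm k c) (trans eq (trans (cong (_+ e) (sym j≡c⊖e)) eqv)))

  ⊕-injectiveʳ : ∀ j e e′ → e < k → e′ < k → j ⊕ e ≡ j ⊕ e′ → e ≡ e′
  ⊕-injectiveʳ j e e′ e<k e′<k eq with j ⊕ e | ⊕-view j e | j ⊕ e′ | ⊕-view j e′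
  ... | _ | no-wrap _  | _ | no-wrap _    = +-cancelˡ-≡ j e e′ eq
  ... | _ | no-wrap _  | w | wrap .w eq′  = ⊥-elim (<⇒≱ e′<k (+-cancelˡ-≤ j k e′ (subst (j + k ≤_) (sym eq′)
    (subst (_≤ k + w) (+-comm k j) (+-monoʳ-≤ k (subst (j ≤_) eq (m≤m+n j e)))))))
  ... | w | wrap .w eq₁ | _ | no-wrap _   = ⊥-elim (<⇒≱ e<k (+-cancelˡ-≤ j k e (subst (j + k ≤_) (sym eq₁)
    (subst (_≤ k + w) (+-comm k j) (+-monoʳ-≤ k (subst (j ≤_) (sym eq) (m≤m+n j e′)))))))
  ... | w | wrap .w eq₁ | w′ | wrap .w′ eq′ = +-cancelˡ-≡ j e e′ (trans eq₁ (trans (cong (k +_) eq) (sym eq′)))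

  ⊖-injectiveʳ : ∀ c e e′ → c < k → e < k → e′ < k → c ⊖ e ≡ c ⊖ e′ → e ≡ e′
  ⊖-injectiveʳ c e e′ c<k e<k e′<k eq = ⊕-injectiveʳ (c ⊖ e) e e′ e<k e′<k
    (trans (sym (⊖⇒⊕ (c ⊖ e) c e c<k (<⇒≤ e<k) refl)) (⊖⇒⊕ (c ⊖ e) c e′ c<k (<⇒≤ e′<k) eq))

  ⊕≡ᵇ-⊖ : ∀ j c e → j < k → c < k → e ≤ k → (c ≡ᵇ j ⊕ e) ≡ (j ≡ᵇ c ⊖ e)
  ⊕≡ᵇ-⊖ j c e j<k c<k e≤k = det (≡ᵇ-reflects-≡ c (j ⊕ e))
    (fromEquivalence (λ j≡c⊖e → ⊖⇒⊕ j c e c<k e≤k (≡ᵇ⇒≡ j (c ⊖ e) j≡c⊖e))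
                     (λ c≡j⊕e → ≡⇒≡ᵇ j (c ⊖ e) (⊕⇒⊖ j c e j<k e≤k c≡j⊕e)))

  shift : ℕ → ℕ → ℕ → Bool
  shift s a b = image (λ d → a ⊕ suc d) s b

  shift-irrefl : ∀ s a → s < k → a < k → shift s a a ≡ false
  shift-irrefl s a s<k a<k = anyBelow-none s _ λ d d<s → ≡ᵇ-false λ a≡a⊕1+d →
    0≢1+n (⊕-injectiveʳ a 0 (suc d) (≤-<-trans z≤n a<k) (≤-<-trans d<s s<k)
      (trans (⊕-no-wrap a 0 (subst (_< k) (sym (+-identityʳ a)) a<k)) (trans (+-identityʳ a) a≡a⊕1+d)))

  count-shift-from : ∀ s a → s < k → a < k → count (shift s a) k ≡ s
  count-shift-from s a s<k a<k = count-image k s (λ d → a ⊕ suc d)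
    (λ d d<s → ⊕-< a (suc d) a<k (<-trans d<s s<k))
    (λ d d′ d<s d′<s eq → suc-injective
      (⊕-injectiveʳ a (suc d) (suc d′) (≤-<-trans d<s s<k) (≤-<-trans d′<s s<k) eq))

  count-shift-to : ∀ s c → s < k → c < k → count (λ a → shift s a c) k ≡ s
  count-shift-to s c s<k c<k = begin
    count (λ a → shift s a c) k               ≡⟨ count-cong k (λ a a<k → anyBelow-cong s λ d d<s →
                                                   ⊕≡ᵇ-⊖ a c (suc d) a<k c<k (<-trans d<s s<k)) ⟩
    count (image (λ d → c ⊖ suc d) s) k      ≡⟨ count-image k s (λ d → c ⊖ suc d)
                                                   (λ d d<s → ⊖-< c (suc d) c<k (<-trans d<s s<k))
                                                   (λ d d′ d<s d′<s eq → suc-injective (⊖-injectiveʳ c (suc d) (suc d′)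
                                                     c<k (≤-<-trans d<s s<k) (≤-<-trans d′<s s<k) eq)) ⟩
    s                                         ∎
    where open ≡-Reasoning

module Colourings where

  open import Data.Fin.Base using (punchOut; zero; suc)
  open import Data.Fin.Properties using (punchOut-injective; injective⇒≤)
    renaming (_≟_ to _≟ᶠ_)
  open import Data.Fin.Permutation.Components using (transpose; transpose-inverse)
  open import Data.Vec.Base using ([]; _∷_; here; there)
  open import Relation.Nullary.Decidable using (dec-true; dec-false)

  clique⇒≤colours : ∀ {n m} (G : Graph n) (v : Fin m → Fin n) → (∀ i j → i ≢ j → Adj G (v i) (v j)) →
    ∀ c → Colorable G c → m ≤ c
  clique⇒≤colours G v clique c (f , f-proper) = injective⇒≤ {f = λ i → f (v i)} injective
    where
    injective : ∀ {i j} → f (v i) ≡ f (v j) → i ≡ j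
    injective {i} {j} eq with i ≟ᶠ j
    ... | yes i≡j = i≡j
    ... | no  i≢j = ⊥-elim (f-proper (v i) (v j) (clique i j i≢j) eq)

  colour-forced : ∀ {n m} (G : Graph n) {f : Fin n → Fin m} → Proper G f → ∀ v c →
    (∀ t → t ≢ c → ∃ λ w → Adj G v w × f w ≡ t) → f v ≡ c
  colour-forced G {f} f-proper v c seen with f v ≟ᶠ c
  ... | yes fv≡c = fv≡c
  ... | no  fv≢c with seen (f v) fv≢c
  ...   | w , vw , fw≡fv = ⊥-elim (f-proper v w vw (sym fw≡fv))

  transpose-fix : ∀ {m} {a b x : Fin m} → x ≢ a → x ≢ b → transpose a b x ≡ x
  transpose-fix {a = a} {b} {x} x≢a x≢b rewrite dec-false (x ≟ᶠ a) x≢a | dec-false (x ≟ᶠ b) x≢b = refl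

  transpose-first : ∀ {m} (a b : Fin m) → transpose a b a ≡ b
  transpose-first a b rewrite dec-true (a ≟ᶠ a) refl = refl

  transpose-injective : ∀ {m} (a b : Fin m) {x y} → transpose a b x ≡ transpose a b y → x ≡ y
  transpose-injective a b eq =
    trans (sym (transpose-inverse b a)) (trans (cong (transpose b a) eq) (transpose-inverse b a))

  absent-pair⇒colorable : ∀ {n K} (G : Graph n) {S p} → IsDefiningSet G (suc K) S p →
    ∀ a b → a ≢ b → (∀ v → v ∈ S → p v ≢ a) → (∀ v → v ∈ S → p v ≢ b) → Colorable G K
  absent-pair⇒colorable G {S} {p} ((f , f-proper , f-extends) , unique) a b a≢b a∉pS b∉pS =
    (λ v → punchOut (a∉f v)) ,
    (λ u v uv eq → f-proper u v uv (punchOut-injective (a∉f u) (a∉f v) eq))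
    where
    swapped = λ v → transpose a b (f v)
    swapped-proper : Proper G swapped
    swapped-proper u v uv eq = f-proper u v uv (transpose-injective a b eq)
    swapped-extends : Extends S p swapped
    swapped-extends v v∈S =
      trans (cong (transpose a b) (f-extends v v∈S)) (transpose-fix (a∉pS v v∈S) (b∉pS v v∈S))
    a∉f : ∀ v → a ≢ f v
    a∉f v a≡fv = a≢b (begin
      a                   ≡⟨ a≡fv ⟩
      f v                 ≡⟨ unique f swapped f-proper f-extends swapped-proper swapped-extends v ⟩
      transpose a b (f v) ≡⟨ cong (transpose a b) a≡fv ⟨
      transpose a b a     ≡⟨ transpose-first a b ⟩
      b                   ∎)
      where open ≡-Reasoning

  colourUsed : ∀ {n K} → Subset n → (Fin n → Fin K) → ℕ → Bool
  colourUsed []      p c = false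
  colourUsed (b ∷ S) p c = (b ∧ (c ≡ᵇ toℕ (p zero))) ∨ colourUsed S (λ v → p (suc v)) c

  count-colourUsed : ∀ {n K} (S : Subset n) (p : Fin n → Fin K) → count (colourUsed S p) K ≤ ∣ S ∣
  count-colourUsed {K = K} []          p = ≤-reflexive (count-none K (λ _ _ → refl))
  count-colourUsed {K = K} (true ∷ S)  p = begin
    count (colourUsed (true ∷ S) p) K
      ≤⟨ count-∨-≤ K (_≡ᵇ toℕ (p zero)) (colourUsed S (λ v → p (suc v))) ⟩
    count (_≡ᵇ toℕ (p zero)) K + count (colourUsed S (λ v → p (suc v))) K
      ≡⟨ cong (_+ count (colourUsed S (λ v → p (suc v))) K) (count-≡ᵇ K (toℕ (p zero)) (toℕ<n (p zero))) ⟩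
    suc (count (colourUsed S (λ v → p (suc v))) K)
      ≤⟨ s≤s (count-colourUsed S (λ v → p (suc v))) ⟩
    suc ∣ S ∣ ∎
    where open ≤-Reasoning
  count-colourUsed         (false ∷ S) p = count-colourUsed S (λ v → p (suc v))

  colourUsed-false : ∀ {n K} (S : Subset n) (p : Fin n → Fin K) c → colourUsed S p c ≡ false →
    ∀ v → v ∈ S → toℕ (p v) ≢ c
  colourUsed-false (_ ∷ S) p c unused zero    here     p0≡c
    rewrite ≡ᵇ-true (sym p0≡c) with unused
  ... | ()
  colourUsed-false (b ∷ S) p c unused (suc v) (there v∈S) =
    colourUsed-false S (λ v → p (suc v)) c (∨-falseʳ unused) v v∈S
    where
    ∨-falseʳ : ∀ {x y} → x ∨ y ≡ false → y ≡ false
    ∨-falseʳ {false} eq = eq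

  defining-set-size : ∀ {n K} (G : Graph n) → ChromaticNumber G (suc K) →
    ∀ S p → IsDefiningSet G (suc K) S p → K ≤ ∣ S ∣
  defining-set-size {K = K} G (_ , minimal) S p def with K ≤? ∣ S ∣
  ... | yes K≤∣S∣ = K≤∣S∣
  ... | no  K≰∣S∣
    with count-two-witnesses (suc K) (λ c → not (colourUsed S p c)) two-unused
    where
    used = count (colourUsed S p) (suc K)
    unused = count (λ c → not (colourUsed S p c)) (suc K)
    two-unused : 2 ≤ unused
    two-unused = +-cancelˡ-≤ used 2 unused (begin
      used + 2         ≡⟨ +-comm used 2 ⟩
      2 + used         ≤⟨ s≤s (s≤s (count-colourUsed S p)) ⟩
      2 + ∣ S ∣        ≤⟨ s≤s (≰⇒> K≰∣S∣) ⟩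
      suc K            ≡⟨ count-complement (suc K) (colourUsed S p) ⟨
      used + unused    ∎)
      where open ≤-Reasoning
  ... | c , c′ , c<K , c′<K , c≢c′ , c-unused , c′-unused =
    ⊥-elim (<-irrefl refl (minimal K (absent-pair⇒colorable G def (fromℕ< c<K) (fromℕ< c′<K)
      (λ eq → c≢c′ (trans (sym (toℕ-fromℕ< c<K)) (trans (cong toℕ eq) (toℕ-fromℕ< c′<K))))
      (absent c<K c-unused) (absent c′<K c′-unused))))
    where
    absent : ∀ {c} (c<K : c < suc K) → not (colourUsed S p c) ≡ true → ∀ v → v ∈ S → p v ≢ fromℕ< c<K
    absent {c} c<K c-unused v v∈S pv≡c = colourUsed-false S p c (not-true c-unused) v v∈S
      (trans (cong toℕ pv≡c) (toℕ-fromℕ< c<K))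
      where
      not-true : ∀ {x} → not x ≡ true → x ≡ false
      not-true {false} _ = refl

open Colourings using (clique⇒≤colours; colour-forced; defining-set-size)

module Construction (r s : ℕ) (1≤r : 1 ≤ r) where

  k : ℕ
  k = suc (r + s)

  open Cyclic k

  r<k : r < k
  r<k = s≤s (m≤m+n r s)

  s<k : s < k
  s<k = s≤s (m≤n+m s r)

  -- The digraph on the colours [0, k): a → a + 1, …, a + s (mod k), except that the
  -- arcs a → a + 1 with a ≥ r are dropped and the arc r → 0 is added (when s > 0).
  dropped added arc : ℕ → ℕ → Bool
  dropped a b = ((r ≤ᵇ a) ∧ (0 <ᵇ s)) ∧ (b ≡ᵇ a ⊕ 1)
  added   a b = ((a ≡ᵇ r) ∧ (0 <ᵇ s)) ∧ (b ≡ᵇ 0)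
  arc     a b = (shift s a b ∧ not (dropped a b)) ∨ added a b

  dropped⇒shift : ∀ a b → dropped a b ≡ true → shift s a b ≡ true
  dropped⇒shift a b is-dropped with ∧-true⁻ is-dropped
  ... | guard , b≡a⊕1 = anyBelow-intro s _ 0 (invert-true (<ᵇ-reflects-< 0 s) (proj₂ (∧-true⁻ guard))) b≡a⊕1

  ¬shift-r-0 : shift s r 0 ≡ false
  ¬shift-r-0 = anyBelow-none s _ λ d d<s → ≡ᵇ-false λ 0≡ →
    0≢1+n (trans 0≡ (trans (⊕-no-wrap r (suc d) (s≤s (+-monoʳ-≤ r d<s))) (+-suc r d)))

  added-disjoint : ∀ a b → (shift s a b ∧ not (dropped a b)) ∧ added a b ≡ false
  added-disjoint a b with added a b in is-added
  ... | false = ∧-zeroʳ _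
  ... | true with ∧-true⁻ is-added
  ...   | a≡r∧0<s , b≡0 with ∧-true⁻ a≡r∧0<s
  ...     | a≡r , _ rewrite invert-true (≡ᵇ-reflects-≡ a r) a≡r | invert-true (≡ᵇ-reflects-≡ b 0) b≡0
    = cong (λ x → (x ∧ not (dropped r 0)) ∧ true) ¬shift-r-0

  0<s : ∀ {a} → r < a → a < k → 0 < s
  0<s {a} r<a a<k = +-cancelˡ-< r 0 s
    (subst (_< r + s) (sym (+-identityʳ r)) (<-≤-trans r<a (s≤s⁻¹ a<k)))

  out-balance : ∀ a → a < k →
    bool→ℕ ((a ≡ᵇ r) ∧ (0 <ᵇ s)) + bool→ℕ (r <ᵇ a) ≡ bool→ℕ ((r ≤ᵇ a) ∧ (0 <ᵇ s))
  out-balance a a<k with <-cmp a r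
  ... | tri< a<r _ _
    rewrite ≡ᵇ-false (<⇒≢ a<r) | det (<ᵇ-reflects-< r a) (ofⁿ (<⇒≯ a<r))
          | det (≤ᵇ-reflects-≤ r a) (ofⁿ (<⇒≱ a<r)) = refl
  ... | tri≈ _ refl _
    rewrite ≡ᵇ-refl a | det (<ᵇ-reflects-< a a) (ofⁿ (<-irrefl refl))
          | det (≤ᵇ-reflects-≤ a a) (ofʸ ≤-refl) = +-identityʳ _
  ... | tri> _ a≢r r<a
    rewrite ≡ᵇ-false a≢r | det (<ᵇ-reflects-< r a) (ofʸ r<a)
          | det (≤ᵇ-reflects-≤ r a) (ofʸ (<⇒≤ r<a)) | det (<ᵇ-reflects-< 0 s) (ofʸ (0<s r<a a<k)) = refl

  in-balance : ∀ c → c < k →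
    bool→ℕ ((c ≡ᵇ 0) ∧ (0 <ᵇ s)) + bool→ℕ (r <ᵇ c) ≡ bool→ℕ ((r ≤ᵇ c ⊖ 1) ∧ (0 <ᵇ s))
  in-balance zero    _   rewrite det (≤ᵇ-reflects-≤ r (r + s)) (ofʸ (m≤m+n r s)) = +-identityʳ _
  in-balance (suc c) c<k with r <ᵇ suc c | <ᵇ-reflects-< r (suc c)
  ... | true  | ofʸ r<c
    rewrite det (≤ᵇ-reflects-≤ r c) (ofʸ (s≤s⁻¹ r<c)) | det (<ᵇ-reflects-< 0 s) (ofʸ (0<s r<c c<k)) = refl
  ... | false | ofⁿ r≮c rewrite det (≤ᵇ-reflects-≤ r c) (ofⁿ (λ r≤c → r≮c (s≤s r≤c))) = refl

  out-degree : ∀ a → a < k → count (arc a) k + bool→ℕ (r <ᵇ a) ≡ s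
  out-degree a a<k = trans
    (count-modify k (shift s a) (dropped a) (added a) (bool→ℕ (r <ᵇ a))
      (λ b _ → dropped⇒shift a b) (λ b _ → added-disjoint a b) (begin
        count (added a) k + bool→ℕ (r <ᵇ a)             ≡⟨ cong (_+ bool→ℕ (r <ᵇ a)) (count-∧-≡ᵇ k 0 _ z<s) ⟩
        bool→ℕ ((a ≡ᵇ r) ∧ (0 <ᵇ s)) + bool→ℕ (r <ᵇ a) ≡⟨ out-balance a a<k ⟩
        bool→ℕ ((r ≤ᵇ a) ∧ (0 <ᵇ s))                    ≡⟨ count-∧-≡ᵇ k (a ⊕ 1) _ (⊕-< a 1 a<k (s≤s z≤n)) ⟨
        count (dropped a) k                              ∎))
    (count-shift-from s a s<k a<k)
    where open ≡-Reasoning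

  in-degree : ∀ c → c < k → count (λ a → arc a c) k + bool→ℕ (r <ᵇ c) ≡ s
  in-degree c c<k = trans
    (count-modify k (λ a → shift s a c) (λ a → dropped a c) (λ a → added a c) (bool→ℕ (r <ᵇ c))
      (λ a _ → dropped⇒shift a c) (λ a _ → added-disjoint a c) (begin
        count (λ a → added a c) k + bool→ℕ (r <ᵇ c)        ≡⟨ cong (_+ bool→ℕ (r <ᵇ c)) (trans
                                                                (count-cong k λ a _ → ∧-rotate (a ≡ᵇ r) (0 <ᵇ s) (c ≡ᵇ 0))
                                                                (count-∧-≡ᵇ k r _ r<k)) ⟩
        bool→ℕ ((c ≡ᵇ 0) ∧ (0 <ᵇ s)) + bool→ℕ (r <ᵇ c)    ≡⟨ in-balance c c<k ⟩
        bool→ℕ ((r ≤ᵇ c ⊖ 1) ∧ (0 <ᵇ s))                  ≡⟨ count-∧-≡ᵇ k (c ⊖ 1) _ (⊖-< c 1 c<k (s≤s z≤n)) ⟨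
        count (λ a → ((r ≤ᵇ c ⊖ 1) ∧ (0 <ᵇ s)) ∧ (a ≡ᵇ c ⊖ 1)) k ≡⟨ count-cong k dropped-into-c ⟨
        count (λ a → dropped a c) k                         ∎))
    (count-shift-to s c s<k c<k)
    where
    open ≡-Reasoning
    ∧-rotate : ∀ x y z → (x ∧ y) ∧ z ≡ (z ∧ y) ∧ x
    ∧-rotate true  y true  = refl
    ∧-rotate true  y false = ∧-zeroʳ y
    ∧-rotate false y true  = sym (∧-zeroʳ y)
    ∧-rotate false y false = refl
    dropped-into-c : ∀ a → a < k → dropped a c ≡ ((r ≤ᵇ c ⊖ 1) ∧ (0 <ᵇ s)) ∧ (a ≡ᵇ c ⊖ 1)
    dropped-into-c a a<k rewrite ⊕≡ᵇ-⊖ a c 1 a<k c<k (s≤s z≤n)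
      with a ≡ᵇ c ⊖ 1 | ≡ᵇ-reflects-≡ a (c ⊖ 1)
    ... | true  | ofʸ refl = refl
    ... | false | _       = trans (∧-zeroʳ _) (sym (∧-zeroʳ _))

  r≢0 : r ≢ 0
  r≢0 r≡0 = <⇒≢ 1≤r (sym r≡0)

  arc-irrefl : ∀ a → a < k → arc a a ≡ false
  arc-irrefl a a<k rewrite shift-irrefl s a s<k a<k with a ≡ᵇ r | ≡ᵇ-reflects-≡ a r
  ... | false | _        = refl
  ... | true  | ofʸ refl rewrite ≡ᵇ-false r≢0 = ∧-zeroʳ _

  arc-below-r : ∀ a b → a < r → arc a b ≡ shift s a b
  arc-below-r a b a<r rewrite ≡ᵇ-false {a} {r} (<⇒≢ a<r) | det (≤ᵇ-reflects-≤ r a) (ofⁿ (<⇒≱ a<r))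
    = trans (∨-identityʳ _) (∧-identityʳ _)

  arc-upward : ∀ a b → a < r → arc a b ≡ true → a < b
  arc-upward a b a<r is-arc with anyBelow-witness s _ (trans (sym (arc-below-r a b a<r)) is-arc)
  ... | d , d<s , b≡a⊕1+d = subst (a <_)
    (sym (trans (invert-true (≡ᵇ-reflects-≡ b _) b≡a⊕1+d) (⊕-no-wrap a (suc d) (s≤s (+-mono-≤ (<⇒≤ a<r) d<s)))))
    (m<m+n a z<s)

  N : ℕ
  N = k + (k + s)

  data Vertex : Set where
    x y z : ℕ → Vertex

  Valid : Vertex → Set
  Valid (x a) = a < k
  Valid (y a) = a < k
  Valid (z i) = i < s

  index : Vertex → ℕ
  index (x a) = a
  index (y a) = k + a
  index (z i) = k + (k + i)

  vertex : ℕ → Vertex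
  vertex u = if u <ᵇ k then x u else if u ∸ k <ᵇ k then y (u ∸ k) else z (u ∸ k ∸ k)

  index-< : ∀ w → Valid w → index w < N
  index-< (x a) a<k = <-≤-trans a<k (m≤m+n k (k + s))
  index-< (y a) a<k = +-monoʳ-< k (<-≤-trans a<k (m≤m+n k s))
  index-< (z i) i<s = +-monoʳ-< k (+-monoʳ-< k i<s)

  vertex-index : ∀ w → Valid w → vertex (index w) ≡ w
  vertex-index (x a) a<k rewrite det (<ᵇ-reflects-< a k) (ofʸ a<k) = refl
  vertex-index (y a) a<k
    rewrite det (<ᵇ-reflects-< (k + a) k) (ofⁿ (≤⇒≯ (m≤m+n k a))) | m+n∸m≡n k a
          | det (<ᵇ-reflects-< a k) (ofʸ a<k) = refl
  vertex-index (z i) _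
    rewrite det (<ᵇ-reflects-< (k + (k + i)) k) (ofⁿ (≤⇒≯ (m≤m+n k (k + i)))) | m+n∸m≡n k (k + i)
          | det (<ᵇ-reflects-< (k + i) k) (ofⁿ (≤⇒≯ (m≤m+n k i))) | m+n∸m≡n k i = refl

  decompose : ∀ u → u < N → ∃ λ w → Valid w × index w ≡ u
  decompose u u<N with u <? k
  ... | yes u<k = x u , u<k , refl
  ... | no  u≮k with u ∸ k <? k
  ...   | yes u∸k<k = y (u ∸ k) , u∸k<k , m+[n∸m]≡n (≮⇒≥ u≮k)
  ...   | no  u∸k≮k = z (u ∸ k ∸ k) , i<s , eq
    where
    eq : k + (k + (u ∸ k ∸ k)) ≡ u
    eq = trans (cong (k +_) (m+[n∸m]≡n (≮⇒≥ u∸k≮k))) (m+[n∸m]≡n (≮⇒≥ u≮k))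
    i<s : u ∸ k ∸ k < s
    i<s = +-cancelˡ-< k _ s (+-cancelˡ-< k _ (k + s) (subst (_< N) (sym eq) u<N))

  vertex-valid : ∀ u → u < N → Valid (vertex u)
  vertex-valid u u<N with decompose u u<N
  ... | w , valid , refl = subst Valid (sym (vertex-index w valid)) valid

  index-vertex : ∀ u → u < N → index (vertex u) ≡ u
  index-vertex u u<N with decompose u u<N
  ... | w , valid , refl = cong index (vertex-index w valid)

  countV : (Vertex → Bool) → ℕ
  countV P = count (λ a → P (x a)) k + (count (λ a → P (y a)) k + count (λ i → P (z i)) s)

  count-vertex : ∀ P → count (λ u → P (vertex u)) N ≡ countV P
  count-vertex P = trans (count-+ k (k + s) (λ u → P (vertex u))) (cong₂ _+_
    (count-cong k λ a a<k → cong P (vertex-index (x a) a<k))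
    (trans (count-+ k s (λ u → P (vertex (k + u)))) (cong₂ _+_
      (count-cong k λ a a<k → cong P (vertex-index (y a) a<k))
      (count-cong s λ i i<s → cong P (vertex-index (z i) i<s)))))

  -- independent v w: v = w or v w is not an edge of G.  The colour classes of the
  -- colouring below are {x a, y a} for a ≤ r and {x a, y a, z (a ∸ suc r)} for a > r.
  independent : Vertex → Vertex → Bool
  independent (x a) (x b) = b ≡ᵇ a
  independent (x a) (y b) = (b ≡ᵇ a) ∨ arc a b
  independent (x a) (z i) = a ≡ᵇ suc r + i
  independent (y b) (x a) = (a ≡ᵇ b) ∨ arc a b
  independent (y a) (y b) = b ≡ᵇ a
  independent (y a) (z i) = a ≡ᵇ suc r + i
  independent (z i) (x a) = a ≡ᵇ suc r + i
  independent (z i) (y a) = a ≡ᵇ suc r + i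
  independent (z i) (z j) = true

  independent-refl : ∀ w → independent w w ≡ true
  independent-refl (x a) = ≡ᵇ-refl a
  independent-refl (y a) = ≡ᵇ-refl a
  independent-refl (z i) = refl

  independent-sym : ∀ v w → independent v w ≡ independent w v
  independent-sym (x a) (x b) = ≡ᵇ-sym b a
  independent-sym (x a) (y b) = cong (_∨ arc a b) (≡ᵇ-sym b a)
  independent-sym (x a) (z i) = refl
  independent-sym (y b) (x a) = cong (_∨ arc a b) (≡ᵇ-sym a b)
  independent-sym (y a) (y b) = ≡ᵇ-sym b a
  independent-sym (y a) (z i) = refl
  independent-sym (z i) (x a) = refl
  independent-sym (z i) (y a) = refl
  independent-sym (z i) (z j) = refl

  count-independent : ∀ w → Valid w → countV (independent w) ≡ 2 + s
  count-independent (x a) a<k = begin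
    count (_≡ᵇ a) k + (count (λ b → (b ≡ᵇ a) ∨ arc a b) k + count (λ i → a ≡ᵇ suc r + i) s)
      ≡⟨ cong₂ (λ m n → m + (n + count (λ i → a ≡ᵇ suc r + i) s)) (count-≡ᵇ k a a<k)
               (trans (count-∨-disjoint k (_≡ᵇ a) (arc a) (λ b _ → loop-free b))
                      (cong (_+ count (arc a) k) (count-≡ᵇ k a a<k))) ⟩
    1 + ((1 + count (arc a) k) + count (λ i → a ≡ᵇ suc r + i) s)
      ≡⟨ cong (λ m → 2 + (count (arc a) k + m)) (count-≡ᵇ-+ (suc r) s a a<k) ⟩
    2 + (count (arc a) k + bool→ℕ (r <ᵇ a))
      ≡⟨ cong (2 +_) (out-degree a a<k) ⟩
    2 + s ∎
    where
    open ≡-Reasoning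
    loop-free : ∀ b → (b ≡ᵇ a) ∧ arc a b ≡ false
    loop-free b with b ≡ᵇ a | ≡ᵇ-reflects-≡ b a
    ... | false | _        = refl
    ... | true  | ofʸ refl = arc-irrefl b a<k
  count-independent (y c) c<k = begin
    count (λ a → (a ≡ᵇ c) ∨ arc a c) k + (count (_≡ᵇ c) k + count (λ i → c ≡ᵇ suc r + i) s)
      ≡⟨ cong₂ (λ m n → m + (n + count (λ i → c ≡ᵇ suc r + i) s))
               (trans (count-∨-disjoint k (_≡ᵇ c) (λ a → arc a c) (λ a _ → loop-free a))
                      (cong (_+ count (λ a → arc a c) k) (count-≡ᵇ k c c<k)))
               (count-≡ᵇ k c c<k) ⟩
    (1 + count (λ a → arc a c) k) + (1 + count (λ i → c ≡ᵇ suc r + i) s)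
      ≡⟨ cong (λ m → suc (count (λ a → arc a c) k + suc m)) (count-≡ᵇ-+ (suc r) s c c<k) ⟩
    1 + (count (λ a → arc a c) k + (1 + bool→ℕ (r <ᵇ c)))
      ≡⟨ cong suc (+-suc _ _) ⟩
    2 + (count (λ a → arc a c) k + bool→ℕ (r <ᵇ c))
      ≡⟨ cong (2 +_) (in-degree c c<k) ⟩
    2 + s ∎
    where
    open ≡-Reasoning
    loop-free : ∀ a → (a ≡ᵇ c) ∧ arc a c ≡ false
    loop-free a with a ≡ᵇ c | ≡ᵇ-reflects-≡ a c
    ... | false | _        = refl
    ... | true  | ofʸ refl = arc-irrefl a c<k
  count-independent (z i) i<s = cong₂ (λ m n → m + (m + n))
    (count-≡ᵇ k (suc r + i) (s≤s (+-monoʳ-< r i<s))) (count-all s (λ _ _ → refl))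

  adjacent : ℕ → ℕ → Bool
  adjacent u v = not (independent (vertex u) (vertex v))

  G : Graph N
  G = record
    { adj    = λ u v → adjacent (toℕ u) (toℕ v)
    ; sym    = λ u v → cong not (independent-sym (vertex (toℕ u)) (vertex (toℕ v)))
    ; irrefl = λ v → cong not (independent-refl (vertex (toℕ v)))
    }

  node : ∀ w → Valid w → Fin N
  node w valid = fromℕ< (index-< w valid)

  vertex-node : ∀ w valid → vertex (toℕ (node w valid)) ≡ w
  vertex-node w valid = trans (cong vertex (toℕ-fromℕ< (index-< w valid))) (vertex-index w valid)

  node-adjacent : ∀ v w vv wv → independent v w ≡ false → Adj G (node v vv) (node w wv)
  node-adjacent v w vv wv vw rewrite vertex-node v vv | vertex-node w wv | vw = refl

  G-regular : Regular G (2 * (k ∸ 1))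
  G-regular v = +-cancelˡ-≡ (2 + s) _ _ (begin
    (2 + s) + degree G v
      ≡⟨ cong₂ _+_ closed (sym (∣tabulate∣ N (adjacent (toℕ v)))) ⟨
    count (λ w → independent u (vertex w)) N + count (λ w → not (independent u (vertex w))) N
      ≡⟨ count-complement N (λ w → independent u (vertex w)) ⟩
    N
      ≡⟨ N≡ r s ⟩
    (2 + s) + 2 * (k ∸ 1) ∎)
    where
    open ≡-Reasoning
    u = vertex (toℕ v)
    closed : count (λ w → independent u (vertex w)) N ≡ 2 + s
    closed = trans (count-vertex (independent u)) (count-independent u (vertex-valid (toℕ v) (toℕ<n v)))
    N≡ : ∀ r s → suc (r + s) + (suc (r + s) + s) ≡ (2 + s) + 2 * (r + s)
    N≡ = solve-∀

  colour : Vertex → ℕ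
  colour (x a) = a
  colour (y a) = a
  colour (z i) = suc r + i

  colour-< : ∀ w → Valid w → colour w < k
  colour-< (x a) a<k = a<k
  colour-< (y a) a<k = a<k
  colour-< (z i) i<s = s≤s (+-monoʳ-< r i<s)

  same-colour⇒independent : ∀ v w → colour v ≡ colour w → independent v w ≡ true
  same-colour⇒independent (x a) (x b) a≡b = ≡ᵇ-true (sym a≡b)
  same-colour⇒independent (x a) (y b) a≡b rewrite ≡ᵇ-true (sym a≡b) = refl
  same-colour⇒independent (x a) (z i) a≡i = ≡ᵇ-true a≡i
  same-colour⇒independent (y b) (x a) b≡a rewrite ≡ᵇ-true (sym b≡a) = refl
  same-colour⇒independent (y a) (y b) a≡b = ≡ᵇ-true (sym a≡b)
  same-colour⇒independent (y a) (z i) a≡i = ≡ᵇ-true a≡i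
  same-colour⇒independent (z i) (x a) i≡a = ≡ᵇ-true (sym i≡a)
  same-colour⇒independent (z i) (y a) i≡a = ≡ᵇ-true (sym i≡a)
  same-colour⇒independent (z i) (z j) _   = refl

  col : Fin N → Fin k
  col v = fromℕ< (colour-< (vertex (toℕ v)) (vertex-valid (toℕ v) (toℕ<n v)))

  toℕ-col : ∀ v → toℕ (col v) ≡ colour (vertex (toℕ v))
  toℕ-col v = toℕ-fromℕ< _

  col-proper : Proper G col
  col-proper u v uv same with () ← trans (sym (cong not
    (same-colour⇒independent (vertex (toℕ u)) (vertex (toℕ v))
      (trans (sym (toℕ-col u)) (trans (cong toℕ same) (toℕ-col v)))))) uv

  G-chromatic : ChromaticNumber G k
  G-chromatic = (col , col-proper) , clique⇒≤colours G (λ a → node (x (toℕ a)) (toℕ<n a)) X-clique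
    where
    X-clique : ∀ a b → a ≢ b → Adj G (node (x (toℕ a)) (toℕ<n a)) (node (x (toℕ b)) (toℕ<n b))
    X-clique a b a≢b = node-adjacent (x (toℕ a)) (x (toℕ b)) (toℕ<n a) (toℕ<n b)
      (≡ᵇ-false λ b≡a → a≢b (toℕ-injective (sym b≡a)))

  c₀ : ℕ
  c₀ = r ⊕ 1

  c₀<k : c₀ < k
  c₀<k = ⊕-< r 1 r<k (s≤s z≤n)

  c₀≢r : c₀ ≢ r
  c₀≢r c₀≡r = 1≢0 (⊕-injectiveʳ r 1 0 (s≤s (≤-trans 1≤r (m≤m+n r s))) (s≤s z≤n)
    (trans c₀≡r (sym (trans (⊕-no-wrap r 0 (subst (_< k) (sym (+-identityʳ r)) r<k)) (+-identityʳ r)))))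
    where
    1≢0 : 1 ≢ 0
    1≢0 ()

  -- r lies at distance k − 1 ≥ s + 1 after c₀ = r + 1, since r ≥ 1.
  ¬shift-c₀-r : shift s c₀ r ≡ false
  ¬shift-c₀-r = anyBelow-none s _ λ d d<s → ≡ᵇ-false (r≢c₀⊕ d d<s)
    where
    r≢c₀⊕ : ∀ d → d < s → r ≢ c₀ ⊕ suc d
    r≢c₀⊕ d d<s rewrite ⊕-no-wrap r 1 (s≤s (+-monoʳ-≤ r (≤-trans (s≤s z≤n) d<s)))
      with (r + 1) ⊕ suc d | ⊕-view (r + 1) (suc d)
    ... | _ | no-wrap _ = λ r≡ → <-irrefl r≡ (<-≤-trans (m<m+n r z<s) (m≤m+n (r + 1) (suc d)))
    ... | w | wrap .w eq = λ { refl → r≢0 (n≤0⇒n≡0 (+-cancelˡ-≤ s r 0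
          (subst (_≤ s + 0) (+-cancelˡ-≡ (r + 1) (suc d) (s + r) (trans eq (shuffle r s)))
            (subst (suc d ≤_) (sym (+-identityʳ s)) d<s)))) }
      where
      shuffle : ∀ r s → suc (r + s) + r ≡ r + 1 + (s + r)
      shuffle = solve-∀

  ¬arc-c₀-r : arc c₀ r ≡ false
  ¬arc-c₀-r rewrite ¬shift-c₀-r | ≡ᵇ-false c₀≢r = refl

  inS : Vertex → Bool
  inS (x a) = not (a ≡ᵇ c₀) ∧ not (a ≡ᵇ r)
  inS (y a) = a ≡ᵇ r
  inS (z i) = false

  S : Subset N
  S = tabulate (λ v → inS (vertex (toℕ v)))

  ∣S∣≡k∸1 : ∣ S ∣ ≡ k ∸ 1
  ∣S∣≡k∸1 = begin
    ∣ S ∣                                ≡⟨ ∣tabulate∣ N (λ u → inS (vertex u)) ⟩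
    count (λ u → inS (vertex u)) N       ≡⟨ count-vertex inS ⟩
    count (λ a → inS (x a)) k + (count (_≡ᵇ r) k + count (λ _ → false) s)
      ≡⟨ cong₂ (λ m n → m + (n + count (λ _ → false) s)) (count-cong k λ a _ → not-∨ (a ≡ᵇ c₀) (a ≡ᵇ r))
                                                        (count-≡ᵇ k r r<k) ⟩
    count (λ a → not (both a)) k + (1 + count (λ _ → false) s)
      ≡⟨ cong (λ m → count (λ a → not (both a)) k + suc m) (count-none s (λ _ _ → refl)) ⟩
    count (λ a → not (both a)) k + 1     ≡⟨ +-comm _ 1 ⟩
    suc (count (λ a → not (both a)) k)   ≡⟨ suc-injective (trans (cong (_+ count (λ a → not (both a)) k) (sym count-both)) (count-complement k both)) ⟩
    k ∸ 1                                ∎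
    where
    open ≡-Reasoning
    both : ℕ → Bool
    both a = (a ≡ᵇ c₀) ∨ (a ≡ᵇ r)
    not-∨ : ∀ p q → not p ∧ not q ≡ not (p ∨ q)
    not-∨ true  q = refl
    not-∨ false q = refl
    count-both : count both k ≡ 2
    count-both = trans (count-∨-disjoint k (_≡ᵇ c₀) (_≡ᵇ r) disjoint)
                       (cong₂ _+_ (count-≡ᵇ k c₀ c₀<k) (count-≡ᵇ k r r<k))
      where
      disjoint : ∀ a → a < k → (a ≡ᵇ c₀) ∧ (a ≡ᵇ r) ≡ false
      disjoint a _ with a ≡ᵇ c₀ | ≡ᵇ-reflects-≡ a c₀
      ... | false | _        = refl
      ... | true  | ofʸ refl = ≡ᵇ-false c₀≢r

  module Forcing (f : Fin N → Fin k) (f-proper : Proper G f) (f-extends : Extends S col f) where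

    Forced : Vertex → Set
    Forced w = ∀ valid → toℕ (f (node w valid)) ≡ colour w

    data Seen (w : Vertex) (t : ℕ) : Set where
      seen-at : ∀ w′ → Valid w′ → independent w w′ ≡ false → Forced w′ → colour w′ ≡ t → Seen w t

    forced-by-neighbours : ∀ w → (∀ t → t < k → t ≢ colour w → Seen w t) → Forced w
    forced-by-neighbours w seen valid = trans
      (cong toℕ (colour-forced G f-proper (node w valid) (fromℕ< (colour-< w valid)) seen′))
      (toℕ-fromℕ< (colour-< w valid))
      where
      seen′ : ∀ t → t ≢ fromℕ< (colour-< w valid) → ∃ λ v → Adj G (node w valid) v × f v ≡ t
      seen′ t t≢ with seen (toℕ t) (toℕ<n t) (λ t≡ → t≢ (toℕ-injective (trans t≡ (sym (toℕ-fromℕ< _)))))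
      ... | seen-at w′ valid′ ww′ forced′ colour≡t =
        node w′ valid′ , node-adjacent w w′ valid valid′ ww′ , toℕ-injective (trans (forced′ valid′) colour≡t)

    forced-in-S : ∀ w → inS w ≡ true → Forced w
    forced-in-S w w∈S valid = begin
      toℕ (f (node w valid))                  ≡⟨ cong toℕ (f-extends (node w valid) node∈S) ⟩
      toℕ (col (node w valid))                ≡⟨ toℕ-col (node w valid) ⟩
      colour (vertex (toℕ (node w valid)))    ≡⟨ cong colour (vertex-node w valid) ⟩
      colour w                                ∎
      where
      open ≡-Reasoning
      node∈S : node w valid ∈ S
      node∈S = lookup⇒[]= (node w valid) S (trans (lookup∘tabulate (λ v → inS (vertex (toℕ v))) (node w valid))
                                                  (trans (cong inS (vertex-node w valid)) w∈S))

    forced-y-r : Forced (y r)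
    forced-y-r = forced-in-S (y r) (≡ᵇ-refl r)

    forced-x-other : ∀ a → a ≢ c₀ → a ≢ r → Forced (x a)
    forced-x-other a a≢c₀ a≢r = forced-in-S (x a) (cong₂ (λ p q → not p ∧ not q) (≡ᵇ-false a≢c₀) (≡ᵇ-false a≢r))

    forced-x-c₀ : Forced (x c₀)
    forced-x-c₀ = forced-by-neighbours (x c₀) seen
      where
      seen : ∀ t → t < k → t ≢ c₀ → Seen (x c₀) t
      seen t t<k t≢c₀ with t ≟ r
      ... | yes refl = seen-at (y r) r<k (cong₂ _∨_ (≡ᵇ-false (c₀≢r ∘ sym)) ¬arc-c₀-r) forced-y-r refl
      ... | no  t≢r  = seen-at (x t) t<k (≡ᵇ-false t≢c₀) (forced-x-other t t≢c₀ t≢r) refl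

    forced-x-r : Forced (x r)
    forced-x-r = forced-by-neighbours (x r) seen
      where
      seen : ∀ t → t < k → t ≢ r → Seen (x r) t
      seen t t<k t≢r with t ≟ c₀
      ... | yes refl = seen-at (x c₀) c₀<k (≡ᵇ-false c₀≢r) forced-x-c₀ refl
      ... | no  t≢c₀ = seen-at (x t) t<k (≡ᵇ-false t≢r) (forced-x-other t t≢c₀ t≢r) refl

    forced-x : ∀ a → Forced (x a)
    forced-x a with a ≟ c₀ | a ≟ r
    ... | yes refl | _        = forced-x-c₀
    ... | no  _    | yes refl = forced-x-r
    ... | no  a≢c₀ | no  a≢r  = forced-x-other a a≢c₀ a≢r

    forced-z : ∀ i → Forced (z i)
    forced-z i = forced-by-neighbours (z i) λ t t<k t≢ → seen-at (x t) t<k (≡ᵇ-false t≢) (forced-x t) refl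

    -- Induction on c: a colour t ≠ c absent from the X-neighbours of y c is an arc
    -- t → c, and is then seen at y t (t < r, where t < c), y r (t = r) or a Z-vertex (t > r).
    forced-y : ∀ c → Forced (y c)
    forced-y = <-rec (λ c → Forced (y c)) λ c IH → forced-by-neighbours (y c) (seen c IH)
      where
      seen : ∀ c → (∀ {t} → t < c → Forced (y t)) → ∀ t → t < k → t ≢ c → Seen (y c) t
      seen c IH t t<k t≢c with arc t c in tc | <-cmp t r
      ... | false | _ = seen-at (x t) t<k (cong₂ _∨_ (≡ᵇ-false t≢c) tc) (forced-x t) refl
      ... | true | tri< t<r _ _ =
        seen-at (y t) t<k (≡ᵇ-false t≢c) (IH (arc-upward t c t<r tc)) refl
      ... | true | tri≈ _ refl _ = seen-at (y r) r<k (≡ᵇ-false t≢c) forced-y-r refl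
      ... | true | tri> _ _ r<t =
        seen-at (z i) i<s (≡ᵇ-false (λ c≡ → t≢c (trans (sym t≡) (sym c≡)))) (forced-z i) t≡
        where
        i = t ∸ suc r
        t≡ : suc r + i ≡ t
        t≡ = m+[n∸m]≡n r<t
        i<s : i < s
        i<s = +-cancelˡ-< (suc r) i s (subst (_< k) (sym t≡) t<k)

    forced : ∀ v → f v ≡ col v
    forced v = toℕ-injective (begin
      toℕ (f v)                     ≡⟨ cong (toℕ ∘ f) (toℕ-injective (sym (trans (toℕ-node w valid) (index-vertex (toℕ v) (toℕ<n v))))) ⟩
      toℕ (f (node w valid))        ≡⟨ forced-all w valid ⟩
      colour w                      ≡⟨ toℕ-col v ⟨
      toℕ (col v)                   ∎)
      where
      open ≡-Reasoning
      w = vertex (toℕ v)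
      valid = vertex-valid (toℕ v) (toℕ<n v)
      toℕ-node : ∀ w valid → toℕ (node w valid) ≡ index w
      toℕ-node w valid = toℕ-fromℕ< (index-< w valid)
      forced-all : ∀ w → Forced w
      forced-all (x a) = forced-x a
      forced-all (y c) = forced-y c
      forced-all (z i) = forced-z i

  S-defining : IsDefiningSet G k S col
  S-defining = (col , col-proper , λ _ _ → refl) ,
    λ f g f-proper f-extends g-proper g-extends v →
      trans (Forcing.forced f f-proper f-extends v) (sym (Forcing.forced g g-proper g-extends v))

  minRegDefiningNumber≡k∸1 : MinRegDefiningNumber N (2 * (k ∸ 1)) k (k ∸ 1)
  minRegDefiningNumber≡k∸1 =
    (G , G-regular , G-chromatic , (S , col , S-defining , ∣S∣≡k∸1) , defining-set-size G G-chromatic) ,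
    λ G′ _ χ d ((S′ , p′ , defining , ∣S′∣≡d) , _) →
      subst (k ∸ 1 ≤_) ∣S′∣≡d (defining-set-size G′ χ S′ p′ defining)

theorem3p3 : (k n : ℕ) → 2 ∣ k → 4 ≤ k → 2 * k ≤ n → n ≤ 3 * k ∸ 2 →
    MinRegDefiningNumber n (2 * (k ∸ 1)) k (k ∸ 1)
theorem3p3 k@(suc (suc k₂)) n _ (s≤s (s≤s _)) 2k≤n n≤3k∸2 =
  subst (λ m → MinRegDefiningNumber m (2 * (k ∸ 1)) k (k ∸ 1)) n≡k+[k+s]
    (subst (λ k → MinRegDefiningNumber (k + (k + s)) (2 * (k ∸ 1)) k (k ∸ 1)) k≡
      (Construction.minRegDefiningNumber≡k∸1 (suc (k₂ ∸ s)) s (s≤s z≤n)))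
  where
  s = n ∸ 2 * k
  s≤k₂ : s ≤ k₂
  s≤k₂ = +-cancelˡ-≤ (2 * k) s k₂ (begin
    2 * k + s     ≡⟨ m+[n∸m]≡n 2k≤n ⟩
    n             ≤⟨ n≤3k∸2 ⟩
    3 * k ∸ 2     ≡⟨ cong (_∸ 2) (+-comm k (2 * k)) ⟩
    2 * k + k ∸ 2 ≡⟨ +-∸-assoc (2 * k) (s≤s (s≤s z≤n)) ⟩
    2 * k + k₂    ∎)
    where open ≤-Reasoning
  k≡ : suc (suc (k₂ ∸ s) + s) ≡ k
  k≡ = cong (suc ∘ suc) (m∸n+n≡m s≤k₂)
  n≡k+[k+s] : k + (k + s) ≡ n
  n≡k+[k+s] = trans (sym (+-assoc k k s)) (trans (cong (λ m → k + m + s) (sym (+-identityʳ k))) (m+[n∸m]≡n 2k≤n))
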